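{- For all positive integers $n$ and $k$, there is no generalized bent function $f:\mathbb{Z}_3^n\to\mathbb{Z}_{2^k}$.
   Context: A function $f:G\to\mathbb{Z}_m$ on a finite abelian group $G$ is a generalized bent function if $\left|\sum_{x\in G}\zeta_m^{f(x)}\chi(x)\right|^2=|G|$ for every character $\chi$ of $G$, where $\zeta_m$ is a primitive $m$-th root of unity. -}

module Defs where

open import Data.Nat as ℕ using (ℕ; zero; suc; _≤?_; _∸_)
open import Data.Nat.Divisibility using (_∣?_)
open import Data.Integer as ℤ using (ℤ; +_; 0ℤ; 1ℤ)
open import Data.Fin using (Fin; toℕ) renaming (zero to f0; suc to fs)
open import Data.Vec using (Vec; []; _∷_; zipWith)
open import Data.List as L using (List; []; _∷_; _++_; [_])
open import Data.Bool using (true; false; if_then_else_)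
open import Data.Product using (∃)
open import Relation.Nullary.Decidable using (does; _×-dec_)
open import Relation.Binary.PropositionalEquality using (_≡_)

-- Integer polynomials, coefficient lists (lowest degree first)

Poly : Set
Poly = List ℤ

infixl 6 _+ₚ_ _-ₚ_
infixl 7 _*ₚ_

_+ₚ_ : Poly → Poly → Poly
[] +ₚ q = q
(a ∷ p) +ₚ [] = a ∷ p
(a ∷ p) +ₚ (b ∷ q) = (a ℤ.+ b) ∷ (p +ₚ q)

negₚ : Poly → Poly
negₚ = L.map (λ a → ℤ.- a)

_-ₚ_ : Poly → Poly → Poly
p -ₚ q = p +ₚ negₚ q

_*ₚ_ : Poly → Poly → Poly
[] *ₚ q = []
(a ∷ p) *ₚ q = L.map (a ℤ.*_) q +ₚ (0ℤ ∷ (p *ₚ q))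

monomial : ℕ → ℤ → Poly
monomial e c = L.replicate e 0ℤ ++ [ c ]

const : ℤ → Poly
const c = [ c ]

sumₚ : List Poly → Poly
sumₚ = L.foldr _+ₚ_ []

prodₚ : List Poly → Poly
prodₚ = L.foldr _*ₚ_ (const 1ℤ)

coeff : Poly → ℕ → ℤ
coeff [] i = 0ℤ
coeff (a ∷ p) zero = a
coeff (a ∷ p) (suc i) = coeff p i

strip : Poly → Poly
strip [] = []
strip (a ∷ p) with strip p
... | [] = if does (a ℤ.≟ 0ℤ) then [] else [ a ]
... | b ∷ q = a ∷ b ∷ q

lastCoeff : Poly → ℤ
lastCoeff [] = 0ℤ
lastCoeff (a ∷ []) = a
lastCoeff (a ∷ b ∷ p) = lastCoeff (b ∷ p)

-- quotient of p by a monic polynomial d (long division, with fuel)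
quotMonicF : ℕ → Poly → Poly → Poly
quotMonicF zero p d = []
quotMonicF (suc fuel) p d =
  let p' = strip p in
  if does (L.length p' ℕ.<? L.length d) then [] else
    (let t = monomial (L.length p' ∸ L.length d) (lastCoeff p')
     in t +ₚ quotMonicF fuel (p' -ₚ t *ₚ d) d)

quotMonic : Poly → Poly → Poly
quotMonic p d = quotMonicF (suc (L.length p)) p (strip d)

properDivisors : ℕ → List ℕ
properDivisors N = L.filter (λ d → (1 ≤? d) ×-dec (d ∣? N)) (L.upTo N)

-- cyclotomic polynomials via  x^N - 1 = ∏_{d ∣ N} Φ_d
cycloF : ℕ → ℕ → Poly
cycloF zero N = []
cycloF (suc fuel) N =
  quotMonic (monomial N 1ℤ -ₚ const 1ℤ) (prodₚ (L.map (cycloF fuel) (properDivisors N)))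

Φ : ℕ → Poly
Φ N = cycloF N N

-- divisibility in ℤ[x] (coefficientwise equality, so trailing zeros are irrelevant)
_∣ₚ_ : Poly → Poly → Set
d ∣ₚ p = ∃ λ q → ∀ i → coeff p i ≡ coeff (q *ₚ d) i

-- Equality in the cyclotomic ring ℤ[ζ_N] ≅ ℤ[x]/(Φ_N), ζ_N ↦ x
_≈[_]_ : Poly → ℕ → Poly → Set
p ≈[ N ] q = Φ N ∣ₚ (p -ₚ q)

-- complex conjugation on ℤ[ζ_N]:  ζ_N^i ↦ ζ_N^{(N-1) i} = ζ_N^{-i}
conjF : ℕ → ℕ → Poly → Poly
conjF N i [] = []
conjF N i (a ∷ p) = monomial ((N ∸ 1) ℕ.* i) a +ₚ conjF N (suc i) p

conj : ℕ → Poly → Poly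
conj N = conjF N 0

normSq : ℕ → Poly → Poly
normSq N z = z *ₚ conj N z

_+₃_ : Fin 3 → Fin 3 → Fin 3
a +₃ b = Data.Fin.fromℕ< (Data.Nat.DivMod.m%n<n (toℕ a ℕ.+ toℕ b) 3)
  where import Data.Fin
        import Data.Nat.DivMod

_⊕_ : ∀ {n} → Vec (Fin 3) n → Vec (Fin 3) n → Vec (Fin 3) n
_⊕_ = zipWith _+₃_

allZ3 : ∀ n → List (Vec (Fin 3) n)
allZ3 zero = [ [] ]
allZ3 (suc n) = L.cartesianProductWith _∷_ (L.allFin 3) (allZ3 n)

-- All values live in ℤ[ζ_N] with N = 3·2^k: ζ_{2^k} = ζ_N^3, and every
-- character of ℤ₃ⁿ takes values in the cube roots of unity ⊆ μ_N.
-- A character is represented by exponents: χ x = j means value ζ_N^j.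

Nk : ℕ → ℕ
Nk k = 3 ℕ.* (2 ℕ.^ k)

IsCharacter : ∀ n k → (Vec (Fin 3) n → ℕ) → Set
IsCharacter n k χ = ∀ x y →
  monomial (χ (x ⊕ y)) 1ℤ ≈[ Nk k ] monomial (χ x ℕ.+ χ y) 1ℤ

-- Σ_x ζ_{2^k}^{f(x)} χ(x)
walsh : ∀ n k → (Vec (Fin 3) n → Fin (2 ℕ.^ k)) → (Vec (Fin 3) n → ℕ) → Poly
walsh n k f χ = sumₚ (L.map (λ x → monomial (3 ℕ.* toℕ (f x) ℕ.+ χ x) 1ℤ) (allZ3 n))

IsGBent : ∀ n k → (Vec (Fin 3) n → Fin (2 ℕ.^ k)) → Set
IsGBent n k f = ∀ χ → IsCharacter n k χ →
  normSq (Nk k) (walsh n k f χ) ≈[ Nk k ] const (+ (3 ℕ.^ n))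

-- All values of a generalized bent function f : ℤ₃ⁿ → ℤ_{2^k} and of the characters of ℤ₃ⁿ lie in
-- ℤ[ζ_N] ≅ ℤ[x]/(Φ_N) with N = 3·2^k. Reducing coefficients mod 2 and sending x to a primitive cube
-- root of unity ω ∈ 𝔽₄ kills Φ_N (for j ≥ 1, Φ_{3·2^j} = y² − y + 1 with y = x^{2^(j-1)}, and
-- ω^{2^(j-1)} is again a primitive cube root of unity), so it is a ring map ℤ[ζ_N] → 𝔽₄, and it sends
-- every ζ_{2^k}^{f(x)} to 1. For the character χ(x) = ζ₃^{x₀} the Walsh sum therefore maps to
-- 3^{n-1}(1 + c + c²) = 0 with c = ω^{2^k}, so |W|² maps to 0, while 3ⁿ maps to 1.
-- Φ_N itself is identified by verifying x^M − 1 = Φ_M · ∏_{d ∣ M, d < M} Φ_d, the recursion defining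
-- Φ, for M = 2^j and M = 3·2^j.

module Submission where

open import Defs
open import Data.Nat using (ℕ; _≤_; _^_)
open import Data.Fin using (Fin)
open import Data.Vec using (Vec)
open import Relation.Nullary using (¬_)

open import Data.Nat as ℕ using (zero; suc; _+_; _*_; _<_; _≤?_; z≤n; s≤s)
import Data.Nat.Properties as ℕ
open import Data.Nat.Divisibility
  using (_∣_; _∣?_; divides; ∣-refl; ∣1⇒≡1; ∣m⇒∣m*n; ∣n⇒∣m*n; *-monoʳ-∣; *-cancelˡ-∣)
open import Data.Nat.Coprimality using (Coprime; coprime-divisor)
open import Data.Nat.Primality using (prime[2]; prime?; prime⇒irreducible)
open import Data.Nat.Tactic.RingSolver using (solve-∀)
open import Data.Integer as ℤ using (ℤ; +_; 0ℤ; 1ℤ)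
import Data.Integer.Properties as ℤ
open import Data.Fin using (toℕ) renaming (zero to 0F; suc to sucF)
import Data.Fin as Fin
open import Data.Fin.Properties using (all?; _≟_)
open import Data.Vec using (_∷_)
open import Data.Bool using (true; false)
open import Data.Maybe using (Maybe; just; nothing)
open import Data.Product using (_×_; _,_; ∃)
open import Data.Sum using (_⊎_; inj₁; inj₂)
open import Data.List as L using (List; []; _∷_; _++_)
open import Data.List.Properties using (map-++)
open import Data.List.Membership.Propositional using (_∈_)
open import Data.List.Membership.Propositional.Properties
  using (∈-filter⁻; ∈-filter⁺; ∈-upTo⁻; ∈-upTo⁺; ∈-applyDownFrom⁻; ∈-applyDownFrom⁺; ∈-++⁻; ∈-++⁺ˡ; ∈-++⁺ʳ)
open import Data.List.Membership.Propositional.Properties.WithK using (unique∧set⇒bag)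
open import Data.List.Relation.Binary.BagAndSetEquality using (∼bag⇒↭)
open import Data.List.Relation.Binary.Permutation.Propositional using (_↭_; ↭⇒↭ₛ′)
import Data.List.Relation.Binary.Permutation.Propositional.Properties as ↭
import Data.List.Relation.Binary.Permutation.Setoid.Properties as PermutationSetoidProperties
open import Data.List.Relation.Unary.Unique.Propositional using (Unique)
import Data.List.Relation.Unary.Unique.Propositional.Properties as Unique
open import Function.Bundles using (mk⇔)
open import Relation.Nullary using (yes; no; contradiction)
open import Relation.Nullary.Decidable using (from-yes; from-no; _×-dec_; _→-dec_)
open import Relation.Nullary.Reflects using (ofʸ; ofⁿ)
open import Relation.Binary.Bundles using (Setoid)
open import Relation.Binary.PropositionalEquality
  using (_≡_; _≢_; refl; sym; trans; cong; cong₂; subst; subst₂; module ≡-Reasoning)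
import Relation.Binary.Reasoning.Setoid as SetoidReasoning
open import Algebra.Bundles using (AbelianGroup; CommutativeRing)
import Algebra.Properties.CommutativeSemigroup as CommutativeSemigroupProperties
open import Algebra.Solver.Ring.AlmostCommutativeRing
  using (fromCommutativeRing; _-Raw-AlmostCommutative⟶_)
import Algebra.Solver.Ring as RingSolver

-- Integer polynomials up to coefficientwise equality

infix 4 _≈ₚ_
record _≈ₚ_ (p q : Poly) : Set where
  constructor coeffwise
  field coeff-≡ : ∀ i → coeff p i ≡ coeff q i
open _≈ₚ_

≈ₚ-refl : ∀ {p} → p ≈ₚ p
≈ₚ-refl = coeffwise λ _ → refl

≈ₚ-sym : ∀ {p q} → p ≈ₚ q → q ≈ₚ p
≈ₚ-sym p≈q = coeffwise λ i → sym (coeff-≡ p≈q i)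

≈ₚ-trans : ∀ {p q r} → p ≈ₚ q → q ≈ₚ r → p ≈ₚ r
≈ₚ-trans p≈q q≈r = coeffwise λ i → trans (coeff-≡ p≈q i) (coeff-≡ q≈r i)

≈ₚ-reflexive : ∀ {p q} → p ≡ q → p ≈ₚ q
≈ₚ-reflexive refl = ≈ₚ-refl

Poly-setoid : Setoid _ _
Poly-setoid = record
  { Carrier = Poly ; _≈_ = _≈ₚ_
  ; isEquivalence = record { refl = ≈ₚ-refl ; sym = ≈ₚ-sym ; trans = ≈ₚ-trans } }

module ≈ₚ-Reasoning = SetoidReasoning Poly-setoid

∷-cong : ∀ {a b p q} → a ≡ b → p ≈ₚ q → (a ∷ p) ≈ₚ (b ∷ q)
∷-cong a≡b p≈q = coeffwise λ { zero → a≡b ; (suc i) → coeff-≡ p≈q i }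

0∷[]≈[] : (0ℤ ∷ []) ≈ₚ []
0∷[]≈[] = coeffwise λ { zero → refl ; (suc i) → refl }

coeff-+ₚ : ∀ p q i → coeff (p +ₚ q) i ≡ coeff p i ℤ.+ coeff q i
coeff-+ₚ [] q i = sym (ℤ.+-identityˡ _)
coeff-+ₚ (a ∷ p) [] i = sym (ℤ.+-identityʳ _)
coeff-+ₚ (a ∷ p) (b ∷ q) zero = refl
coeff-+ₚ (a ∷ p) (b ∷ q) (suc i) = coeff-+ₚ p q i

coeff-negₚ : ∀ p i → coeff (negₚ p) i ≡ ℤ.- coeff p i
coeff-negₚ [] i = refl
coeff-negₚ (a ∷ p) zero = refl
coeff-negₚ (a ∷ p) (suc i) = coeff-negₚ p i

+ₚ-cong : ∀ {p p′ q q′} → p ≈ₚ p′ → q ≈ₚ q′ → p +ₚ q ≈ₚ p′ +ₚ q′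
+ₚ-cong {p} {p′} {q} {q′} p≈p′ q≈q′ = coeffwise λ i →
  trans (coeff-+ₚ p q i) (trans (cong₂ ℤ._+_ (coeff-≡ p≈p′ i) (coeff-≡ q≈q′ i)) (sym (coeff-+ₚ p′ q′ i)))

negₚ-cong : ∀ {p p′} → p ≈ₚ p′ → negₚ p ≈ₚ negₚ p′
negₚ-cong {p} {p′} p≈p′ = coeffwise λ i →
  trans (coeff-negₚ p i) (trans (cong ℤ.-_ (coeff-≡ p≈p′ i)) (sym (coeff-negₚ p′ i)))

+ₚ-assoc : ∀ p q r → (p +ₚ q) +ₚ r ≈ₚ p +ₚ (q +ₚ r)
+ₚ-assoc p q r = coeffwise λ i →
  trans (coeff-+ₚ (p +ₚ q) r i) (trans (cong (ℤ._+ coeff r i) (coeff-+ₚ p q i))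
  (trans (ℤ.+-assoc (coeff p i) _ _)
  (trans (cong (λ x → coeff p i ℤ.+ x) (sym (coeff-+ₚ q r i))) (sym (coeff-+ₚ p (q +ₚ r) i)))))

+ₚ-comm : ∀ p q → p +ₚ q ≈ₚ q +ₚ p
+ₚ-comm p q = coeffwise λ i →
  trans (coeff-+ₚ p q i) (trans (ℤ.+-comm (coeff p i) _) (sym (coeff-+ₚ q p i)))

+ₚ-identityˡ : ∀ p → [] +ₚ p ≈ₚ p
+ₚ-identityˡ p = ≈ₚ-refl

+ₚ-identityʳ : ∀ p → p +ₚ [] ≈ₚ p
+ₚ-identityʳ p = coeffwise λ i → trans (coeff-+ₚ p [] i) (ℤ.+-identityʳ _)

+ₚ-inverseˡ : ∀ p → negₚ p +ₚ p ≈ₚ []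
+ₚ-inverseˡ p = coeffwise λ i →
  trans (coeff-+ₚ (negₚ p) p i) (trans (cong (ℤ._+ coeff p i) (coeff-negₚ p i)) (ℤ.+-inverseˡ (coeff p i)))

+ₚ-inverseʳ : ∀ p → p +ₚ negₚ p ≈ₚ []
+ₚ-inverseʳ p = ≈ₚ-trans (+ₚ-comm p (negₚ p)) (+ₚ-inverseˡ p)

Poly-+-abelianGroup : AbelianGroup _ _
Poly-+-abelianGroup = record
  { Carrier = Poly ; _≈_ = _≈ₚ_ ; _∙_ = _+ₚ_ ; ε = [] ; _⁻¹ = negₚ
  ; isAbelianGroup = record
    { isGroup = record
      { isMonoid = record
        { isSemigroup = record
          { isMagma = record { isEquivalence = Setoid.isEquivalence Poly-setoid ; ∙-cong = +ₚ-cong }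
          ; assoc = +ₚ-assoc }
        ; identity = +ₚ-identityˡ , +ₚ-identityʳ }
      ; inverse = +ₚ-inverseˡ , +ₚ-inverseʳ
      ; ⁻¹-cong = negₚ-cong }
    ; comm = +ₚ-comm } }

+ₚ-interchange : ∀ p q r s → (p +ₚ q) +ₚ (r +ₚ s) ≈ₚ (p +ₚ r) +ₚ (q +ₚ s)
+ₚ-interchange = CommutativeSemigroupProperties.interchange
  (AbelianGroup.commutativeSemigroup Poly-+-abelianGroup)

scale : ℤ → Poly → Poly
scale a = L.map (a ℤ.*_)

coeff-scale : ∀ a p i → coeff (scale a p) i ≡ a ℤ.* coeff p i
coeff-scale a [] i = sym (ℤ.*-zeroʳ a)
coeff-scale a (b ∷ p) zero = refl
coeff-scale a (b ∷ p) (suc i) = coeff-scale a p i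

scale-+ₚ : ∀ a p q → scale a (p +ₚ q) ≈ₚ scale a p +ₚ scale a q
scale-+ₚ a [] q = ≈ₚ-refl
scale-+ₚ a (b ∷ p) [] = ≈ₚ-refl
scale-+ₚ a (b ∷ p) (c ∷ q) = ∷-cong (ℤ.*-distribˡ-+ a b c) (scale-+ₚ a p q)

scale-0 : ∀ p → scale 0ℤ p ≈ₚ []
scale-0 [] = ≈ₚ-refl
scale-0 (a ∷ p) = ≈ₚ-trans (∷-cong refl (scale-0 p)) 0∷[]≈[]

scale-1 : ∀ p → scale 1ℤ p ≈ₚ p
scale-1 [] = ≈ₚ-refl
scale-1 (a ∷ p) = ∷-cong (ℤ.*-identityˡ a) (scale-1 p)

scale-shift : ∀ a p → scale a (0ℤ ∷ p) ≈ₚ 0ℤ ∷ scale a p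
scale-shift a p = ∷-cong (ℤ.*-zeroʳ a) ≈ₚ-refl

scale-scale : ∀ a b p → scale a (scale b p) ≈ₚ scale (a ℤ.* b) p
scale-scale a b [] = ≈ₚ-refl
scale-scale a b (c ∷ p) = ∷-cong (sym (ℤ.*-assoc a b c)) (scale-scale a b p)

scale-cong : ∀ a {p q} → p ≈ₚ q → scale a p ≈ₚ scale a q
scale-cong a {p} {q} p≈q = coeffwise λ i →
  trans (coeff-scale a p i) (trans (cong (a ℤ.*_) (coeff-≡ p≈q i)) (sym (coeff-scale a q i)))

shift-*ₚ : ∀ p q → (0ℤ ∷ p) *ₚ q ≈ₚ 0ℤ ∷ (p *ₚ q)
shift-*ₚ p q = +ₚ-cong (scale-0 q) ≈ₚ-refl

*ₚ-zeroʳ : ∀ p → p *ₚ [] ≈ₚ []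
*ₚ-zeroʳ [] = ≈ₚ-refl
*ₚ-zeroʳ (a ∷ p) = ≈ₚ-trans (∷-cong refl (*ₚ-zeroʳ p)) 0∷[]≈[]

*ₚ-∷ʳ : ∀ p b q → p *ₚ (b ∷ q) ≈ₚ scale b p +ₚ (0ℤ ∷ p *ₚ q)
*ₚ-∷ʳ [] b q = ≈ₚ-sym 0∷[]≈[]
*ₚ-∷ʳ (a ∷ p) b q = ∷-cong (cong (ℤ._+ 0ℤ) (ℤ.*-comm a b)) (begin
  scale a q +ₚ p *ₚ (b ∷ q)                       ≈⟨ +ₚ-cong ≈ₚ-refl (*ₚ-∷ʳ p b q) ⟩
  scale a q +ₚ (scale b p +ₚ (0ℤ ∷ p *ₚ q))       ≈⟨ +ₚ-assoc (scale a q) _ _ ⟨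
  (scale a q +ₚ scale b p) +ₚ (0ℤ ∷ p *ₚ q)       ≈⟨ +ₚ-cong (+ₚ-comm (scale a q) _) ≈ₚ-refl ⟩
  (scale b p +ₚ scale a q) +ₚ (0ℤ ∷ p *ₚ q)       ≈⟨ +ₚ-assoc (scale b p) _ _ ⟩
  scale b p +ₚ (a ∷ p) *ₚ q                       ∎)
  where open ≈ₚ-Reasoning

*ₚ-comm : ∀ p q → p *ₚ q ≈ₚ q *ₚ p
*ₚ-comm [] q = ≈ₚ-sym (*ₚ-zeroʳ q)
*ₚ-comm (a ∷ p) q = ≈ₚ-trans (+ₚ-cong ≈ₚ-refl (∷-cong refl (*ₚ-comm p q))) (≈ₚ-sym (*ₚ-∷ʳ q a p))

*ₚ-congʳ : ∀ p {q q′} → q ≈ₚ q′ → p *ₚ q ≈ₚ p *ₚ q′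
*ₚ-congʳ [] q≈q′ = ≈ₚ-refl
*ₚ-congʳ (a ∷ p) q≈q′ = +ₚ-cong (scale-cong a q≈q′) (∷-cong refl (*ₚ-congʳ p q≈q′))

*ₚ-cong : ∀ {p p′ q q′} → p ≈ₚ p′ → q ≈ₚ q′ → p *ₚ q ≈ₚ p′ *ₚ q′
*ₚ-cong {p} {p′} {q} {q′} p≈p′ q≈q′ = begin
  p *ₚ q   ≈⟨ *ₚ-congʳ p q≈q′ ⟩
  p *ₚ q′  ≈⟨ *ₚ-comm p q′ ⟩
  q′ *ₚ p  ≈⟨ *ₚ-congʳ q′ p≈p′ ⟩
  q′ *ₚ p′ ≈⟨ *ₚ-comm q′ p′ ⟩
  p′ *ₚ q′ ∎
  where open ≈ₚ-Reasoning

*ₚ-distribˡ : ∀ p q r → p *ₚ (q +ₚ r) ≈ₚ p *ₚ q +ₚ p *ₚ r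
*ₚ-distribˡ [] q r = ≈ₚ-refl
*ₚ-distribˡ (a ∷ p) q r = begin
  scale a (q +ₚ r) +ₚ (0ℤ ∷ p *ₚ (q +ₚ r))
    ≈⟨ +ₚ-cong (scale-+ₚ a q r) (∷-cong refl (*ₚ-distribˡ p q r)) ⟩
  (scale a q +ₚ scale a r) +ₚ ((0ℤ ∷ p *ₚ q) +ₚ (0ℤ ∷ p *ₚ r))
    ≈⟨ +ₚ-interchange (scale a q) _ _ _ ⟩
  (a ∷ p) *ₚ q +ₚ (a ∷ p) *ₚ r ∎
  where open ≈ₚ-Reasoning

*ₚ-distribʳ : ∀ p q r → (q +ₚ r) *ₚ p ≈ₚ q *ₚ p +ₚ r *ₚ p
*ₚ-distribʳ p q r = begin
  (q +ₚ r) *ₚ p       ≈⟨ *ₚ-comm (q +ₚ r) p ⟩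
  p *ₚ (q +ₚ r)       ≈⟨ *ₚ-distribˡ p q r ⟩
  p *ₚ q +ₚ p *ₚ r    ≈⟨ +ₚ-cong (*ₚ-comm p q) (*ₚ-comm p r) ⟩
  q *ₚ p +ₚ r *ₚ p    ∎
  where open ≈ₚ-Reasoning

scale-*ₚ : ∀ a p q → scale a p *ₚ q ≈ₚ scale a (p *ₚ q)
scale-*ₚ a [] q = ≈ₚ-refl
scale-*ₚ a (b ∷ p) q = begin
  scale (a ℤ.* b) q +ₚ (0ℤ ∷ scale a p *ₚ q)            ≈⟨ +ₚ-cong (≈ₚ-sym (scale-scale a b q)) (∷-cong refl (scale-*ₚ a p q)) ⟩
  scale a (scale b q) +ₚ (0ℤ ∷ scale a (p *ₚ q))        ≈⟨ +ₚ-cong ≈ₚ-refl (scale-shift a (p *ₚ q)) ⟨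
  scale a (scale b q) +ₚ scale a (0ℤ ∷ p *ₚ q)          ≈⟨ scale-+ₚ a (scale b q) _ ⟨
  scale a ((b ∷ p) *ₚ q)                                ∎
  where open ≈ₚ-Reasoning

*ₚ-assoc : ∀ p q r → (p *ₚ q) *ₚ r ≈ₚ p *ₚ (q *ₚ r)
*ₚ-assoc [] q r = ≈ₚ-refl
*ₚ-assoc (a ∷ p) q r = begin
  (scale a q +ₚ (0ℤ ∷ p *ₚ q)) *ₚ r         ≈⟨ *ₚ-distribʳ r (scale a q) _ ⟩
  scale a q *ₚ r +ₚ (0ℤ ∷ p *ₚ q) *ₚ r      ≈⟨ +ₚ-cong (scale-*ₚ a q r) (shift-*ₚ (p *ₚ q) r) ⟩
  scale a (q *ₚ r) +ₚ (0ℤ ∷ (p *ₚ q) *ₚ r)  ≈⟨ +ₚ-cong ≈ₚ-refl (∷-cong refl (*ₚ-assoc p q r)) ⟩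
  (a ∷ p) *ₚ (q *ₚ r)                       ∎
  where open ≈ₚ-Reasoning

*ₚ-identityˡ : ∀ p → const 1ℤ *ₚ p ≈ₚ p
*ₚ-identityˡ p = ≈ₚ-trans (+ₚ-cong (scale-1 p) 0∷[]≈[]) (+ₚ-identityʳ p)

*ₚ-identityʳ : ∀ p → p *ₚ const 1ℤ ≈ₚ p
*ₚ-identityʳ p = ≈ₚ-trans (*ₚ-comm p (const 1ℤ)) (*ₚ-identityˡ p)

Poly-commutativeRing : CommutativeRing _ _
Poly-commutativeRing = record
  { Carrier = Poly ; _≈_ = _≈ₚ_ ; _+_ = _+ₚ_ ; _*_ = _*ₚ_ ; -_ = negₚ ; 0# = [] ; 1# = const 1ℤ
  ; isCommutativeRing = record
    { isRing = record
      { +-isAbelianGroup = AbelianGroup.isAbelianGroup Poly-+-abelianGroup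
      ; *-cong = *ₚ-cong
      ; *-assoc = *ₚ-assoc
      ; *-identity = *ₚ-identityˡ , *ₚ-identityʳ
      ; distrib = *ₚ-distribˡ , *ₚ-distribʳ }
    ; *-comm = *ₚ-comm } }

const-homomorphism :
  CommutativeRing.rawRing ℤ.+-*-commutativeRing
    -Raw-AlmostCommutative⟶ fromCommutativeRing Poly-commutativeRing
const-homomorphism = record
  { ⟦_⟧ = const
  ; +-homo = λ _ _ → ≈ₚ-refl
  ; *-homo = λ a b → ∷-cong (sym (ℤ.+-identityʳ (a ℤ.* b))) ≈ₚ-refl
  ; -‿homo = λ _ → ≈ₚ-refl
  ; 0-homo = 0∷[]≈[]
  ; 1-homo = ≈ₚ-refl }

const-≟ : ∀ a b → Maybe (const a ≈ₚ const b)
const-≟ a b with a ℤ.≟ b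
... | yes refl = just ≈ₚ-refl
... | no _ = nothing

open RingSolver (CommutativeRing.rawRing ℤ.+-*-commutativeRing) (fromCommutativeRing Poly-commutativeRing)
  const-homomorphism const-≟
  using (solve; _:+_; _:*_; _:-_; :-_; con) renaming (_:=_ to _:≈_)

-- Leading coefficients and exact division by monic polynomials

record DegreeBelow (p : Poly) (n : ℕ) : Set where
  constructor vanishing-from
  field vanishes : ∀ i → n ≤ i → coeff p i ≡ 0ℤ
open DegreeBelow

record TopCoeff (p : Poly) (e : ℕ) (c : ℤ) : Set where
  constructor top-coeff
  field
    coeff-top : coeff p e ≡ c
    degree< : DegreeBelow p (suc e)
open TopCoeff

Monic : Poly → Set
Monic p = ∃ λ e → TopCoeff p e 1ℤ

coeff-≥length : ∀ p i → L.length p ≤ i → coeff p i ≡ 0ℤ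
coeff-≥length [] i _ = refl
coeff-≥length (a ∷ p) (suc i) (s≤s le) = coeff-≥length p i le

DegreeBelow-length : ∀ p → DegreeBelow p (L.length p)
DegreeBelow-length p = vanishing-from (coeff-≥length p)

DegreeBelow-resp : ∀ {p q n} → p ≈ₚ q → DegreeBelow p n → DegreeBelow q n
DegreeBelow-resp p≈q deg = vanishing-from λ i le → trans (sym (coeff-≡ p≈q i)) (vanishes deg i le)

TopCoeff-resp : ∀ {p q e c} → p ≈ₚ q → TopCoeff p e c → TopCoeff q e c
TopCoeff-resp p≈q (top-coeff top deg) = top-coeff (trans (sym (coeff-≡ p≈q _)) top) (DegreeBelow-resp p≈q deg)

TopCoeff-+ₚ : ∀ {p q e c} → TopCoeff p e c → DegreeBelow q e → TopCoeff (p +ₚ q) e c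
TopCoeff-+ₚ {p} {q} {e} (top-coeff top deg) deg-q = top-coeff
  (trans (coeff-+ₚ p q e) (trans (cong₂ ℤ._+_ top (vanishes deg-q e ℕ.≤-refl)) (ℤ.+-identityʳ _)))
  (vanishing-from λ i lt → trans (coeff-+ₚ p q i) (cong₂ ℤ._+_ (vanishes deg i lt) (vanishes deg-q i (ℕ.<⇒≤ lt))))

coeff-∷*ₚ : ∀ a p q i → coeff ((a ∷ p) *ₚ q) (suc i) ≡ a ℤ.* coeff q (suc i) ℤ.+ coeff (p *ₚ q) i
coeff-∷*ₚ a p q i = trans (coeff-+ₚ (scale a q) (0ℤ ∷ p *ₚ q) (suc i)) (cong (ℤ._+ _) (coeff-scale a q (suc i)))

TopCoeff-*ₚ : ∀ p q {e m a b} → TopCoeff p e a → TopCoeff q m b → TopCoeff (p *ₚ q) (e + m) (a ℤ.* b)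
TopCoeff-*ₚ [] q {b = b} (top-coeff refl _) _ = top-coeff (sym (ℤ.*-zeroˡ b)) (vanishing-from λ _ _ → refl)
TopCoeff-*ₚ (c ∷ p) q {zero} {m} (top-coeff refl deg) (top-coeff top-q deg-q) =
  TopCoeff-resp (≈ₚ-sym p*q≈scale) (top-coeff
    (trans (coeff-scale c q m) (cong (c ℤ.*_) top-q))
    (vanishing-from λ i lt → trans (coeff-scale c q i) (trans (cong (c ℤ.*_) (vanishes deg-q i lt)) (ℤ.*-zeroʳ c))))
  where
  p≈[] : p ≈ₚ []
  p≈[] = coeffwise λ i → vanishes deg (suc i) (s≤s z≤n)
  p*q≈scale : (c ∷ p) *ₚ q ≈ₚ scale c q
  p*q≈scale = ≈ₚ-trans (+ₚ-cong ≈ₚ-refl (∷-cong refl (*ₚ-cong p≈[] ≈ₚ-refl))) (≈ₚ-trans (+ₚ-cong ≈ₚ-refl 0∷[]≈[]) (+ₚ-identityʳ _))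
TopCoeff-*ₚ (c ∷ p) q {suc e} {m} {a} {b} (top-coeff top deg) top-q = top-coeff
  (trans (coeff-∷*ₚ c p q (e + m)) (trans (cong₂ ℤ._+_ (c*q-vanishes (ℕ.m≤n+m m e)) (coeff-top ih)) (ℤ.+-identityˡ _)))
  (vanishing-from λ { (suc i) (s≤s lt) → trans (coeff-∷*ₚ c p q i)
    (cong₂ ℤ._+_ (c*q-vanishes (ℕ.≤-trans (ℕ.m≤n+m m e) (ℕ.<⇒≤ lt))) (vanishes (degree< ih) i lt)) })
  where
  ih : TopCoeff (p *ₚ q) (e + m) (a ℤ.* b)
  ih = TopCoeff-*ₚ p q (top-coeff top (vanishing-from λ i lt → vanishes deg (suc i) (s≤s lt))) top-q
  c*q-vanishes : ∀ {i} → m ≤ i → c ℤ.* coeff q (suc i) ≡ 0ℤ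
  c*q-vanishes le = trans (cong (c ℤ.*_) (vanishes (degree< top-q) _ (s≤s le))) (ℤ.*-zeroʳ c)

Monic-*ₚ : ∀ p q → Monic p → Monic q → Monic (p *ₚ q)
Monic-*ₚ p q (e , top-p) (m , top-q) = e + m , TopCoeff-*ₚ p q top-p top-q

strip-≈ₚ : ∀ p → strip p ≈ₚ p
strip-≈ₚ [] = ≈ₚ-refl
strip-≈ₚ (a ∷ p) with strip p | strip-≈ₚ p
... | [] | []≈p with a ℤ.≟ 0ℤ
...   | yes refl = ≈ₚ-trans (≈ₚ-sym 0∷[]≈[]) (∷-cong refl []≈p)
...   | no _ = ∷-cong refl []≈p
strip-≈ₚ (a ∷ p) | b ∷ q | p′≈p = ∷-cong refl p′≈p

strip-length-step : ∀ a p → L.length (strip (a ∷ p)) ≤ suc (L.length (strip p))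
strip-length-step a p with strip p
... | b ∷ q = ℕ.≤-refl
... | [] with a ℤ.≟ 0ℤ
...   | yes _ = z≤n
...   | no _ = ℕ.≤-refl

strip-length≤ : ∀ p n → DegreeBelow p n → L.length (strip p) ≤ n
strip-length≤ [] n _ = z≤n
strip-length≤ (a ∷ p) zero deg with strip p | strip-length≤ p zero (vanishing-from λ i _ → vanishes deg (suc i) z≤n)
... | b ∷ q | ()
... | [] | _ with a ℤ.≟ 0ℤ
...   | yes _ = z≤n
...   | no a≢0 = contradiction (vanishes deg 0 z≤n) a≢0
strip-length≤ (a ∷ p) (suc n) deg = ℕ.≤-trans (strip-length-step a p)
  (s≤s (strip-length≤ p n (vanishing-from λ i le → vanishes deg (suc i) (s≤s le))))

strip-lastCoeff≢0 : ∀ p {b q} → strip p ≡ b ∷ q → lastCoeff (b ∷ q) ≢ 0ℤ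
strip-lastCoeff≢0 [] ()
strip-lastCoeff≢0 (a ∷ p) eq with strip p | strip-lastCoeff≢0 p
... | [] | _ with a ℤ.≟ 0ℤ
strip-lastCoeff≢0 (a ∷ p) () | [] | _ | yes _
strip-lastCoeff≢0 (a ∷ p) refl | [] | _ | no a≢0 = a≢0
strip-lastCoeff≢0 (a ∷ p) refl | c ∷ r | ih = ih refl

TopCoeff-lastCoeff : ∀ a p → TopCoeff (a ∷ p) (L.length p) (lastCoeff (a ∷ p))
TopCoeff-lastCoeff a p = top-coeff (top a p) (DegreeBelow-length (a ∷ p))
  where
  top : ∀ a p → coeff (a ∷ p) (L.length p) ≡ lastCoeff (a ∷ p)
  top a [] = refl
  top a (b ∷ p) = top b p

TopCoeff-monomial : ∀ e c → TopCoeff (monomial e c) e c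
TopCoeff-monomial zero c = top-coeff refl (vanishing-from λ { (suc i) _ → refl })
TopCoeff-monomial (suc e) c = top-coeff (coeff-top (TopCoeff-monomial e c))
  (vanishing-from λ { (suc i) (s≤s le) → vanishes (degree< (TopCoeff-monomial e c)) i le })

TopCoeff-cancel : ∀ {p q e c} → TopCoeff p e c → TopCoeff q e c → DegreeBelow (p -ₚ q) e
TopCoeff-cancel {p} {q} {e} {c} (top-coeff top-p deg-p) (top-coeff top-q deg-q) = vanishing-from λ i e≤i →
  trans (coeff-+ₚ p (negₚ q) i)
        (trans (cong₂ ℤ._+_ (refl {x = coeff p i}) (coeff-negₚ q i)) (difference-vanishes i (ℕ.m≤n⇒m<n∨m≡n e≤i)))
  where
  difference-vanishes : ∀ i → e < i ⊎ e ≡ i → coeff p i ℤ.- coeff q i ≡ 0ℤ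
  difference-vanishes i (inj₁ e<i) = cong₂ ℤ._-_ (vanishes deg-p i e<i) (vanishes deg-q i e<i)
  difference-vanishes i (inj₂ refl) = trans (cong₂ ℤ._-_ top-p top-q) (ℤ.+-inverseʳ c)

module _ {d : Poly} {m : ℕ} (d-top : TopCoeff d m 1ℤ) (d-length : L.length d ≡ suc m) where

  quotient-≈[] : ∀ p q → L.length (strip p) ≤ m → p ≈ₚ q *ₚ d → q ≈ₚ []
  quotient-≈[] p q short p≈qd with strip q in eq
  ... | [] = ≈ₚ-trans (≈ₚ-sym (strip-≈ₚ q)) (≈ₚ-reflexive eq)
  ... | b ∷ r = contradiction c≡0 (strip-lastCoeff≢0 q eq)
    where
    e : ℕ
    e = L.length r + m
    c : ℤ
    c = lastCoeff (b ∷ r)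
    qd-top : TopCoeff (q *ₚ d) e (c ℤ.* 1ℤ)
    qd-top = TopCoeff-*ₚ q d (TopCoeff-resp (≈ₚ-trans (≈ₚ-reflexive (sym eq)) (strip-≈ₚ q)) (TopCoeff-lastCoeff b r)) d-top
    c≡0 : c ≡ 0ℤ
    c≡0 = begin
      c                  ≡⟨ ℤ.*-identityʳ c ⟨
      c ℤ.* 1ℤ           ≡⟨ coeff-top qd-top ⟨
      coeff (q *ₚ d) e   ≡⟨ coeff-≡ p≈qd e ⟨
      coeff p e          ≡⟨ coeff-≡ (strip-≈ₚ p) e ⟨
      coeff (strip p) e  ≡⟨ coeff-≥length (strip p) e (ℕ.≤-trans short (ℕ.m≤n+m m (L.length r))) ⟩
      0ℤ                 ∎
      where open ≡-Reasoning

  -- Each division step removes the top term of the stripped dividend, so its length drops below the fuel.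
  quotMonicF-exact : ∀ fuel p q → L.length (strip p) < fuel → p ≈ₚ q *ₚ d → quotMonicF fuel p d ≈ₚ q
  quotMonicF-exact zero p q () _
  quotMonicF-exact (suc fuel) p q bound p≈qd with strip p in eq
  ... | r with L.length r ℕ.<ᵇ L.length d | ℕ.<ᵇ-reflects-< (L.length r) (L.length d)
  ...   | true | ofʸ short = ≈ₚ-sym (quotient-≈[] p q (ℕ.≤-pred (subst₂ _<_ (cong L.length (sym eq)) d-length short)) p≈qd)
  quotMonicF-exact (suc fuel) p q _ _ | [] | false | ofⁿ long = contradiction (subst (0 <_) (sym d-length) (s≤s z≤n)) long
  quotMonicF-exact (suc fuel) p q bound p≈qd | b ∷ r | false | ofⁿ long = begin
      t +ₚ quotMonicF fuel remainder d  ≈⟨ +ₚ-cong ≈ₚ-refl (quotMonicF-exact fuel remainder (q -ₚ t) remainder-bound remainder≈) ⟩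
      t +ₚ (q -ₚ t)                     ≈⟨ solve 2 (λ t q → t :+ (q :- t) :≈ q) ≈ₚ-refl t q ⟩
      q                                 ∎
    where
    open ≈ₚ-Reasoning
    s : ℕ
    s = suc (L.length r) ℕ.∸ L.length d
    c : ℤ
    c = lastCoeff (b ∷ r)
    t remainder : Poly
    t = monomial s c
    remainder = (b ∷ r) -ₚ t *ₚ d
    s+m≡deg : s + m ≡ L.length r
    s+m≡deg = trans (cong (λ n → suc (L.length r) ℕ.∸ n + m) d-length)
                    (ℕ.m∸n+n≡m (ℕ.≤-pred (subst (_≤ suc (L.length r)) d-length (ℕ.≮⇒≥ long))))
    td-top : TopCoeff (t *ₚ d) (L.length r) c
    td-top = subst₂ (TopCoeff (t *ₚ d)) s+m≡deg (ℤ.*-identityʳ c) (TopCoeff-*ₚ t d (TopCoeff-monomial s c) d-top)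
    remainder-bound : L.length (strip remainder) < fuel
    remainder-bound = ℕ.≤-<-trans (strip-length≤ remainder (L.length r) (TopCoeff-cancel (TopCoeff-lastCoeff b r) td-top))
                                  (ℕ.≤-pred bound)
    remainder≈ : remainder ≈ₚ (q -ₚ t) *ₚ d
    remainder≈ = begin
      (b ∷ r) -ₚ t *ₚ d  ≈⟨ +ₚ-cong (≈ₚ-trans (≈ₚ-reflexive (sym eq)) (≈ₚ-trans (strip-≈ₚ p) p≈qd)) ≈ₚ-refl ⟩
      q *ₚ d -ₚ t *ₚ d   ≈⟨ solve 3 (λ q t d → q :* d :- t :* d :≈ (q :- t) :* d) ≈ₚ-refl q t d ⟩
      (q -ₚ t) *ₚ d      ∎

quotMonic-exact : ∀ P Q D → Monic D → P ≈ₚ Q *ₚ D → quotMonic P D ≈ₚ Q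
quotMonic-exact P Q D (m , D-top) P≈QD =
  quotMonicF-exact stripD-top stripD-length (suc (L.length P)) P Q
    (s≤s (strip-length≤ P (L.length P) (DegreeBelow-length P)))
    (≈ₚ-trans P≈QD (*ₚ-congʳ Q (≈ₚ-sym (strip-≈ₚ D))))
  where
  stripD-top : TopCoeff (strip D) m 1ℤ
  stripD-top = TopCoeff-resp (≈ₚ-sym (strip-≈ₚ D)) D-top
  1≢0 : 1ℤ ≢ 0ℤ
  1≢0 ()
  stripD-length : L.length (strip D) ≡ suc m
  stripD-length = ℕ.≤-antisym (strip-length≤ D (suc m) (degree< D-top)) (ℕ.≮⇒≥ λ short →
    1≢0 (trans (sym (coeff-top stripD-top)) (coeff-≥length (strip D) m (ℕ.≤-pred short))))

2^-∣ : ∀ {i j} → i ≤ j → 2 ^ i ∣ 2 ^ j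
2^-∣ {i} {j} i≤j = divides (2 ^ (j ℕ.∸ i))
  (trans (cong (2 ^_) (sym (ℕ.m∸n+n≡m i≤j))) (ℕ.^-distribˡ-+-* 2 (j ℕ.∸ i) i))

-- Divisors of 2^j and 3·2^j

2^>0 : ∀ j → 0 < 2 ^ j
2^>0 = ℕ.m^n>0 2

2^-mono-< : ∀ {i j} → i < j → 2 ^ i < 2 ^ j
2^-mono-< = ℕ.^-monoʳ-< 2 (s≤s (s≤s z≤n))

2^<3*2^ : ∀ {i j} → i ≤ j → 2 ^ i < 3 * 2 ^ j
2^<3*2^ {i} {j} i≤j = ℕ.≤-<-trans (ℕ.^-monoʳ-≤ 2 i≤j) (ℕ.m<m+n (2 ^ j) (2^>0 (suc j)))

2^≢3*2^ : ∀ i k → 2 ^ i ≢ 3 * 2 ^ k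
2^≢3*2^ zero k eq = from-no (3 ∣? 1) (subst (3 ∣_) (sym eq) (∣m⇒∣m*n (2 ^ k) ∣-refl))
2^≢3*2^ (suc i) zero eq = from-no (2 ∣? 3) (subst (2 ∣_) eq (∣m⇒∣m*n (2 ^ i) ∣-refl))
2^≢3*2^ (suc i) (suc k) eq = 2^≢3*2^ i k (ℕ.*-cancelˡ-≡ (2 ^ i) (3 * 2 ^ k) 2 (trans eq (swap-3-2 (2 ^ k))))
  where
  swap-3-2 : ∀ x → 3 * (2 * x) ≡ 2 * (3 * x)
  swap-3-2 = solve-∀

odd⇒coprime-2 : ∀ {d} → ¬ 2 ∣ d → Coprime d 2
odd⇒coprime-2 2∤d (c∣d , c∣2) with prime⇒irreducible prime[2] c∣2
... | inj₁ c≡1 = c≡1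
... | inj₂ refl = contradiction c∣d 2∤d

∣2^*m⇒ : ∀ j {m d} → d ∣ 2 ^ j * m → ∃ λ i → ∃ λ e → i ≤ j × e ∣ m × d ≡ 2 ^ i * e
∣2^*m⇒ zero {m} {d} d∣1*m = 0 , d , z≤n , subst (d ∣_) (ℕ.*-identityˡ m) d∣1*m , sym (ℕ.*-identityˡ d)
∣2^*m⇒ (suc j) {m} {d} d∣2^1+j*m with 2 ∣? d
... | no 2∤d = let i , e , i≤j , e∣m , d≡ = ∣2^*m⇒ j (coprime-divisor (odd⇒coprime-2 2∤d) d∣2*2^j*m)
               in i , e , ℕ.m≤n⇒m≤1+n i≤j , e∣m , d≡
  where
  d∣2*2^j*m : d ∣ 2 * (2 ^ j * m)
  d∣2*2^j*m = subst (d ∣_) (ℕ.*-assoc 2 (2 ^ j) m) d∣2^1+j*m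
... | yes (divides q refl) with ∣2^*m⇒ j {m} {q} (*-cancelˡ-∣ 2 (subst₂ _∣_ (ℕ.*-comm q 2) (ℕ.*-assoc 2 (2 ^ j) m) d∣2^1+j*m))
...   | i , e , i≤j , e∣m , refl = suc i , e , s≤s i≤j , e∣m , trans (ℕ.*-comm (2 ^ i * e) 2) (sym (ℕ.*-assoc 2 (2 ^ i) e))

∣2^⇒ : ∀ j {d} → d ∣ 2 ^ j → ∃ λ i → i ≤ j × d ≡ 2 ^ i
∣2^⇒ j {d} d∣2^j with i , e , i≤j , e∣1 , refl ← ∣2^*m⇒ j (subst (d ∣_) (sym (ℕ.*-identityʳ (2 ^ j))) d∣2^j)
  rewrite ∣1⇒≡1 e∣1 = i , i≤j , ℕ.*-identityʳ (2 ^ i)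

∣3*2^⇒ : ∀ j {d} → d ∣ 3 * 2 ^ j → ∃ λ i → i ≤ j × (d ≡ 2 ^ i ⊎ d ≡ 3 * 2 ^ i)
∣3*2^⇒ j {d} d∣3*2^j with i , e , i≤j , e∣3 , refl ← ∣2^*m⇒ j (subst (d ∣_) (ℕ.*-comm 3 (2 ^ j)) d∣3*2^j)
  with prime⇒irreducible (from-yes (prime? 3)) e∣3
... | inj₁ refl = i , i≤j , inj₁ (ℕ.*-identityʳ (2 ^ i))
... | inj₂ refl = i , i≤j , inj₂ (ℕ.*-comm (2 ^ i) 3)

∈-properDivisors⁻ : ∀ {N d} → d ∈ properDivisors N → d < N × d ∣ N
∈-properDivisors⁻ d∈ with d∈upTo , _ , d∣N ← ∈-filter⁻ (λ d → (1 ≤? d) ×-dec (d ∣? _)) d∈ = ∈-upTo⁻ d∈upTo , d∣N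

∈-properDivisors⁺ : ∀ {N d} → 1 ≤ d → d < N → d ∣ N → d ∈ properDivisors N
∈-properDivisors⁺ 1≤d d<N d∣N = ∈-filter⁺ (λ d → (1 ≤? d) ×-dec (d ∣? _)) (∈-upTo⁺ d<N) (1≤d , d∣N)

properDivisors-unique : ∀ N → Unique (properDivisors N)
properDivisors-unique N = Unique.filter⁺ (λ d → (1 ≤? d) ×-dec (d ∣? N)) (Unique.upTo⁺ N)

unique-members⇒↭ : ∀ {A : Set} {xs ys : List A} → Unique xs → Unique ys →
  (∀ {x} → x ∈ xs → x ∈ ys) → (∀ {x} → x ∈ ys → x ∈ xs) → xs ↭ ys
unique-members⇒↭ xs! ys! to from = ∼bag⇒↭ (unique∧set⇒bag xs! ys! (mk⇔ to from))

powersOf2 : ℕ → List ℕ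
powersOf2 = L.applyDownFrom (2 ^_)

powersOf2-unique : ∀ j → Unique (powersOf2 j)
powersOf2-unique j = Unique.applyDownFrom⁺₁ (2 ^_) j (λ j<i _ → ℕ.>⇒≢ (2^-mono-< j<i))

triplePowersOf2 : ℕ → List ℕ
triplePowersOf2 = L.applyDownFrom (λ i → 3 * 2 ^ i)

triplePowersOf2-unique : ∀ j → Unique (triplePowersOf2 j)
triplePowersOf2-unique j =
  Unique.applyDownFrom⁺₁ (λ i → 3 * 2 ^ i) j (λ j<i _ → ℕ.>⇒≢ (ℕ.*-monoʳ-< 3 (2^-mono-< j<i)))

properDivisors-2^ : ∀ j → properDivisors (2 ^ j) ↭ powersOf2 j
properDivisors-2^ j = unique-members⇒↭ (properDivisors-unique (2 ^ j)) (powersOf2-unique j) to from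
  where
  to : ∀ {d} → d ∈ properDivisors (2 ^ j) → d ∈ powersOf2 j
  to d∈ with d<2^j , d∣2^j ← ∈-properDivisors⁻ d∈ with i , i≤j , refl ← ∣2^⇒ j d∣2^j =
    ∈-applyDownFrom⁺ (2 ^_) (ℕ.≤∧≢⇒< i≤j λ { refl → ℕ.<-irrefl refl d<2^j })
  from : ∀ {d} → d ∈ powersOf2 j → d ∈ properDivisors (2 ^ j)
  from d∈ with i , i<j , refl ← ∈-applyDownFrom⁻ (2 ^_) d∈ =
    ∈-properDivisors⁺ (2^>0 i) (2^-mono-< i<j) (2^-∣ (ℕ.<⇒≤ i<j))

properDivisors-3*2^ : ∀ j → properDivisors (3 * 2 ^ j) ↭ powersOf2 (suc j) ++ triplePowersOf2 j
properDivisors-3*2^ j = unique-members⇒↭ (properDivisors-unique (3 * 2 ^ j)) unique to from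
  where
  unique : Unique (powersOf2 (suc j) ++ triplePowersOf2 j)
  unique = Unique.++⁺ (powersOf2-unique (suc j)) (triplePowersOf2-unique j) λ (d∈₁ , d∈₂) →
    let i , _ , d≡2^i = ∈-applyDownFrom⁻ (2 ^_) d∈₁
        k , _ , d≡3*2^k = ∈-applyDownFrom⁻ (λ i → 3 * 2 ^ i) d∈₂
    in 2^≢3*2^ i k (trans (sym d≡2^i) d≡3*2^k)
  to : ∀ {d} → d ∈ properDivisors (3 * 2 ^ j) → d ∈ powersOf2 (suc j) ++ triplePowersOf2 j
  to d∈ with d<N , d∣N ← ∈-properDivisors⁻ d∈ with ∣3*2^⇒ j d∣N
  ... | i , i≤j , inj₁ refl = ∈-++⁺ˡ (∈-applyDownFrom⁺ (2 ^_) (s≤s i≤j))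
  ... | i , i≤j , inj₂ refl = ∈-++⁺ʳ (powersOf2 (suc j))
          (∈-applyDownFrom⁺ (λ i → 3 * 2 ^ i) (ℕ.≤∧≢⇒< i≤j λ { refl → ℕ.<-irrefl refl d<N }))
  from : ∀ {d} → d ∈ powersOf2 (suc j) ++ triplePowersOf2 j → d ∈ properDivisors (3 * 2 ^ j)
  from d∈ with ∈-++⁻ (powersOf2 (suc j)) d∈
  ... | inj₁ d∈₁ with i , s≤s i≤j , refl ← ∈-applyDownFrom⁻ (2 ^_) d∈₁ =
    ∈-properDivisors⁺ (2^>0 i) (2^<3*2^ i≤j) (∣n⇒∣m*n 3 (2^-∣ i≤j))
  ... | inj₂ d∈₂ with i , i<j , refl ← ∈-applyDownFrom⁻ (λ i → 3 * 2 ^ i) d∈₂ =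
    ∈-properDivisors⁺ (ℕ.≤-trans (2^>0 i) (ℕ.m≤n*m (2 ^ i) 3)) (ℕ.*-monoʳ-< 3 (2^-mono-< i<j))
      (*-monoʳ-∣ 3 (2^-∣ (ℕ.<⇒≤ i<j)))

-- The cyclotomic polynomials Φ_{2^j} and Φ_{3·2^j}

X^ : ℕ → Poly
X^ e = monomial e 1ℤ

X^-+ : ∀ a b → X^ (a + b) ≈ₚ X^ a *ₚ X^ b
X^-+ zero b = ≈ₚ-sym (*ₚ-identityˡ (X^ b))
X^-+ (suc a) b = ≈ₚ-sym (≈ₚ-trans (shift-*ₚ (X^ a) (X^ b)) (∷-cong refl (≈ₚ-sym (X^-+ a b))))

X^-2* : ∀ a → X^ (2 * a) ≈ₚ X^ a *ₚ X^ a
X^-2* a = ≈ₚ-trans (X^-+ a (a + 0)) (*ₚ-congʳ (X^ a) (≈ₚ-reflexive (cong X^ (ℕ.+-identityʳ a))))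

X^-3* : ∀ a → X^ (3 * a) ≈ₚ X^ a *ₚ (X^ a *ₚ X^ a)
X^-3* a = ≈ₚ-trans (X^-+ a (2 * a)) (*ₚ-congʳ (X^ a) (X^-2* a))

DegreeBelow-X^ : ∀ {a b} → a < b → DegreeBelow (X^ a) b
DegreeBelow-X^ {a} a<b = vanishing-from λ i b≤i → vanishes (degree< (TopCoeff-monomial a 1ℤ)) i (ℕ.≤-trans a<b b≤i)

DegreeBelow-const : ∀ c {b} → 0 < b → DegreeBelow (const c) b
DegreeBelow-const c (s≤s z≤n) = vanishing-from λ { (suc i) _ → refl }

DegreeBelow-negₚ : ∀ {p b} → DegreeBelow p b → DegreeBelow (negₚ p) b
DegreeBelow-negₚ {p} deg = vanishing-from λ i b≤i → trans (coeff-negₚ p i) (cong ℤ.-_ (vanishes deg i b≤i))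

cyclotomic-2^ : ℕ → Poly
cyclotomic-2^ zero = X^ 1 -ₚ const 1ℤ
cyclotomic-2^ (suc j) = X^ (2 ^ j) +ₚ const 1ℤ

cyclotomic-3*2^ : ℕ → Poly
cyclotomic-3*2^ zero = X^ 2 +ₚ X^ 1 +ₚ const 1ℤ
cyclotomic-3*2^ (suc j) = X^ (2 ^ suc j) -ₚ X^ (2 ^ j) +ₚ const 1ℤ

Monic-cyclotomic-2^ : ∀ j → Monic (cyclotomic-2^ j)
Monic-cyclotomic-2^ zero = 1 , TopCoeff-+ₚ (TopCoeff-monomial 1 1ℤ) (DegreeBelow-negₚ (DegreeBelow-const 1ℤ (s≤s z≤n)))
Monic-cyclotomic-2^ (suc j) = 2 ^ j , TopCoeff-+ₚ (TopCoeff-monomial (2 ^ j) 1ℤ) (DegreeBelow-const 1ℤ (2^>0 j))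

Monic-cyclotomic-3*2^ : ∀ j → Monic (cyclotomic-3*2^ j)
Monic-cyclotomic-3*2^ zero =
  2 , TopCoeff-+ₚ (TopCoeff-+ₚ (TopCoeff-monomial 2 1ℤ) (DegreeBelow-X^ (s≤s (s≤s z≤n)))) (DegreeBelow-const 1ℤ (s≤s z≤n))
Monic-cyclotomic-3*2^ (suc j) = 2 ^ suc j ,
  TopCoeff-+ₚ (TopCoeff-+ₚ (TopCoeff-monomial (2 ^ suc j) 1ℤ) (DegreeBelow-negₚ (DegreeBelow-X^ (2^-mono-< (ℕ.n<1+n j)))))
              (DegreeBelow-const 1ℤ (2^>0 (suc j)))

∏< : (ℕ → Poly) → ℕ → Poly
∏< C zero = const 1ℤ
∏< C (suc j) = C j *ₚ ∏< C j

Monic-∏< : ∀ C → (∀ j → Monic (C j)) → ∀ j → Monic (∏< C j)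
Monic-∏< C monic zero = 0 , TopCoeff-monomial 0 1ℤ
Monic-∏< C monic (suc j) = Monic-*ₚ (C j) (∏< C j) (monic j) (Monic-∏< C monic j)

∏<-cyclotomic-2^ : ∀ j → ∏< cyclotomic-2^ (suc j) ≈ₚ X^ (2 ^ j) -ₚ const 1ℤ
∏<-cyclotomic-2^ zero = *ₚ-identityʳ (cyclotomic-2^ 0)
∏<-cyclotomic-2^ (suc j) = begin
  (y +ₚ const 1ℤ) *ₚ ∏< cyclotomic-2^ (suc j)  ≈⟨ *ₚ-congʳ (y +ₚ const 1ℤ) (∏<-cyclotomic-2^ j) ⟩
  (y +ₚ const 1ℤ) *ₚ (y -ₚ const 1ℤ)          ≈⟨ solve 1 (λ y → (y :+ con 1ℤ) :* (y :- con 1ℤ) :≈ y :* y :- con 1ℤ) ≈ₚ-refl y ⟩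
  y *ₚ y -ₚ const 1ℤ                          ≈⟨ +ₚ-cong (X^-2* (2 ^ j)) ≈ₚ-refl ⟨
  X^ (2 ^ suc j) -ₚ const 1ℤ                  ∎
  where
  open ≈ₚ-Reasoning
  y : Poly
  y = X^ (2 ^ j)

∏<-cyclotomic-3*2^ : ∀ j → ∏< cyclotomic-3*2^ (suc j) ≈ₚ X^ (2 ^ suc j) +ₚ X^ (2 ^ j) +ₚ const 1ℤ
∏<-cyclotomic-3*2^ zero = *ₚ-identityʳ (cyclotomic-3*2^ 0)
∏<-cyclotomic-3*2^ (suc j) = begin
  (y² -ₚ y +ₚ const 1ℤ) *ₚ ∏< cyclotomic-3*2^ (suc j)
    ≈⟨ *ₚ-congʳ (y² -ₚ y +ₚ const 1ℤ) (∏<-cyclotomic-3*2^ j) ⟩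
  (y² -ₚ y +ₚ const 1ℤ) *ₚ (y² +ₚ y +ₚ const 1ℤ)
    ≈⟨ *ₚ-cong (+ₚ-cong (+ₚ-cong y²≈y*y ≈ₚ-refl) ≈ₚ-refl) (+ₚ-cong (+ₚ-cong y²≈y*y ≈ₚ-refl) ≈ₚ-refl) ⟩
  (y *ₚ y -ₚ y +ₚ const 1ℤ) *ₚ (y *ₚ y +ₚ y +ₚ const 1ℤ)
    ≈⟨ solve 1 (λ y → (y :* y :- y :+ con 1ℤ) :* (y :* y :+ y :+ con 1ℤ) :≈ (y :* y) :* (y :* y) :+ y :* y :+ con 1ℤ) ≈ₚ-refl y ⟩
  (y *ₚ y) *ₚ (y *ₚ y) +ₚ y *ₚ y +ₚ const 1ℤ
    ≈⟨ +ₚ-cong (+ₚ-cong (≈ₚ-trans (X^-2* (2 ^ suc j)) (*ₚ-cong y²≈y*y y²≈y*y)) y²≈y*y) ≈ₚ-refl ⟨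
  X^ (2 ^ suc (suc j)) +ₚ y² +ₚ const 1ℤ ∎
  where
  open ≈ₚ-Reasoning
  y y² : Poly
  y = X^ (2 ^ j)
  y² = X^ (2 ^ suc j)
  y²≈y*y : y² ≈ₚ y *ₚ y
  y²≈y*y = X^-2* (2 ^ j)

X^3*2^-1-factorisation : ∀ j → X^ (3 * 2 ^ j) -ₚ const 1ℤ ≈ₚ
  cyclotomic-3*2^ j *ₚ (∏< cyclotomic-2^ (suc j) *ₚ ∏< cyclotomic-3*2^ j)
X^3*2^-1-factorisation j = begin
  X^ (3 * 2 ^ j) -ₚ const 1ℤ
    ≈⟨ +ₚ-cong (X^-3* (2 ^ j)) ≈ₚ-refl ⟩
  y *ₚ (y *ₚ y) -ₚ const 1ℤ
    ≈⟨ solve 1 (λ y → y :* (y :* y) :- con 1ℤ :≈ (y :- con 1ℤ) :* (y :* y :+ y :+ con 1ℤ)) ≈ₚ-refl y ⟩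
  (y -ₚ const 1ℤ) *ₚ (y *ₚ y +ₚ y +ₚ const 1ℤ)
    ≈⟨ *ₚ-cong (∏<-cyclotomic-2^ j) (≈ₚ-trans (∏<-cyclotomic-3*2^ j) (+ₚ-cong (+ₚ-cong (X^-2* (2 ^ j)) ≈ₚ-refl) ≈ₚ-refl)) ⟨
  ∏< cyclotomic-2^ (suc j) *ₚ (cyclotomic-3*2^ j *ₚ ∏< cyclotomic-3*2^ j)
    ≈⟨ solve 3 (λ a b c → a :* (b :* c) :≈ b :* (a :* c)) ≈ₚ-refl
         (∏< cyclotomic-2^ (suc j)) (cyclotomic-3*2^ j) (∏< cyclotomic-3*2^ j) ⟩
  cyclotomic-3*2^ j *ₚ (∏< cyclotomic-2^ (suc j) *ₚ ∏< cyclotomic-3*2^ j) ∎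
  where
  open ≈ₚ-Reasoning
  y : Poly
  y = X^ (2 ^ j)

prodₚ-↭ : ∀ {ps qs} → ps ↭ qs → prodₚ ps ≈ₚ prodₚ qs
prodₚ-↭ ps↭qs = PermutationSetoidProperties.foldr-commMonoid Poly-setoid
  (CommutativeRing.*-isCommutativeMonoid Poly-commutativeRing) (↭⇒↭ₛ′ (Setoid.isEquivalence Poly-setoid) ps↭qs)

prodₚ-++ : ∀ ps qs → prodₚ (ps ++ qs) ≈ₚ prodₚ ps *ₚ prodₚ qs
prodₚ-++ [] qs = ≈ₚ-sym (*ₚ-identityˡ (prodₚ qs))
prodₚ-++ (p ∷ ps) qs = ≈ₚ-trans (*ₚ-congʳ p (prodₚ-++ ps qs)) (≈ₚ-sym (*ₚ-assoc p (prodₚ ps) (prodₚ qs)))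

prodₚ-applyDownFrom : ∀ (g : ℕ → Poly) (h : ℕ → ℕ) C n → (∀ {i} → i < n → g (h i) ≈ₚ C i) →
  prodₚ (L.map g (L.applyDownFrom h n)) ≈ₚ ∏< C n
prodₚ-applyDownFrom g h C zero _ = ≈ₚ-refl
prodₚ-applyDownFrom g h C (suc n) g∘h≈C =
  *ₚ-cong (g∘h≈C (ℕ.n<1+n n)) (prodₚ-applyDownFrom g h C n (λ i<n → g∘h≈C (ℕ.m<n⇒m<1+n i<n)))

cycloF-suc-exact : ∀ fuel N C D → Monic D → prodₚ (L.map (cycloF fuel) (properDivisors N)) ≈ₚ D →
  X^ N -ₚ const 1ℤ ≈ₚ C *ₚ D → cycloF (suc fuel) N ≈ₚ C
cycloF-suc-exact fuel N C D (e , D-top) divisors≈D X^N-1≈C*D =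
  quotMonic-exact _ C _ (e , TopCoeff-resp (≈ₚ-sym divisors≈D) D-top)
    (≈ₚ-trans X^N-1≈C*D (*ₚ-congʳ C (≈ₚ-sym divisors≈D)))

cycloF-2^ : ∀ fuel j → 2 ^ j ≤ fuel → cycloF fuel (2 ^ j) ≈ₚ cyclotomic-2^ j
cycloF-2^ zero j 2^j≤0 = contradiction 2^j≤0 (ℕ.<⇒≱ (2^>0 j))
cycloF-2^ (suc fuel) j 2^j≤1+fuel =
  cycloF-suc-exact fuel (2 ^ j) (cyclotomic-2^ j) (∏< cyclotomic-2^ j)
    (Monic-∏< cyclotomic-2^ Monic-cyclotomic-2^ j) divisors≈ (≈ₚ-sym (∏<-cyclotomic-2^ j))
  where
  divisors≈ : prodₚ (L.map (cycloF fuel) (properDivisors (2 ^ j))) ≈ₚ ∏< cyclotomic-2^ j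
  divisors≈ = ≈ₚ-trans (prodₚ-↭ (↭.map⁺ (cycloF fuel) (properDivisors-2^ j)))
    (prodₚ-applyDownFrom (cycloF fuel) (2 ^_) cyclotomic-2^ j λ {i} i<j →
      cycloF-2^ fuel i (ℕ.≤-pred (ℕ.<-≤-trans (2^-mono-< i<j) 2^j≤1+fuel)))

cycloF-3*2^ : ∀ fuel j → 3 * 2 ^ j ≤ fuel → cycloF fuel (3 * 2 ^ j) ≈ₚ cyclotomic-3*2^ j
cycloF-3*2^ zero j N≤0 = contradiction N≤0 (ℕ.<⇒≱ (ℕ.<-trans (2^>0 0) (2^<3*2^ {j = j} z≤n)))
cycloF-3*2^ (suc fuel) j N≤1+fuel =
  cycloF-suc-exact fuel (3 * 2 ^ j) (cyclotomic-3*2^ j) (∏< cyclotomic-2^ (suc j) *ₚ ∏< cyclotomic-3*2^ j)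
    (Monic-*ₚ _ _ (Monic-∏< cyclotomic-2^ Monic-cyclotomic-2^ (suc j)) (Monic-∏< cyclotomic-3*2^ Monic-cyclotomic-3*2^ j))
    divisors≈ (X^3*2^-1-factorisation j)
  where
  divisors≈ : prodₚ (L.map (cycloF fuel) (properDivisors (3 * 2 ^ j))) ≈ₚ ∏< cyclotomic-2^ (suc j) *ₚ ∏< cyclotomic-3*2^ j
  divisors≈ = begin
    prodₚ (L.map (cycloF fuel) (properDivisors (3 * 2 ^ j)))
      ≈⟨ prodₚ-↭ (↭.map⁺ (cycloF fuel) (properDivisors-3*2^ j)) ⟩
    prodₚ (L.map (cycloF fuel) (powersOf2 (suc j) ++ triplePowersOf2 j))
      ≡⟨ cong prodₚ (map-++ (cycloF fuel) (powersOf2 (suc j)) (triplePowersOf2 j)) ⟩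
    prodₚ (L.map (cycloF fuel) (powersOf2 (suc j)) ++ L.map (cycloF fuel) (triplePowersOf2 j))
      ≈⟨ prodₚ-++ (L.map (cycloF fuel) (powersOf2 (suc j))) _ ⟩
    prodₚ (L.map (cycloF fuel) (powersOf2 (suc j))) *ₚ prodₚ (L.map (cycloF fuel) (triplePowersOf2 j))
      ≈⟨ *ₚ-cong
           (prodₚ-applyDownFrom (cycloF fuel) (2 ^_) cyclotomic-2^ (suc j) λ {i} i<1+j →
             cycloF-2^ fuel i (ℕ.≤-pred (ℕ.<-≤-trans (2^<3*2^ (ℕ.≤-pred i<1+j)) N≤1+fuel)))
           (prodₚ-applyDownFrom (cycloF fuel) (λ i → 3 * 2 ^ i) cyclotomic-3*2^ j λ {i} i<j →
             cycloF-3*2^ fuel i (ℕ.≤-pred (ℕ.<-≤-trans (ℕ.*-monoʳ-< 3 (2^-mono-< i<j)) N≤1+fuel))) ⟩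
    ∏< cyclotomic-2^ (suc j) *ₚ ∏< cyclotomic-3*2^ j ∎
    where open ≈ₚ-Reasoning

-- Reduction of ℤ[ζ_N] to 𝔽₄

-- 𝔽₄ = 𝔽₂(ω) with ω² = ω + 1.
𝔽₄ : Set
𝔽₄ = Fin 4

pattern 0𝔽 = Fin.zero
pattern 1𝔽 = Fin.suc Fin.zero
pattern ω = Fin.suc (Fin.suc Fin.zero)
pattern ω² = Fin.suc (Fin.suc (Fin.suc Fin.zero))

infixl 6 _+₄_
infixl 7 _*₄_

_+₄_ : 𝔽₄ → 𝔽₄ → 𝔽₄
0𝔽 +₄ y = y
x +₄ 0𝔽 = x
1𝔽 +₄ 1𝔽 = 0𝔽
1𝔽 +₄ ω = ω²
1𝔽 +₄ ω² = ω
ω +₄ 1𝔽 = ω²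
ω +₄ ω = 0𝔽
ω +₄ ω² = 1𝔽
ω² +₄ 1𝔽 = ω
ω² +₄ ω = 1𝔽
ω² +₄ ω² = 0𝔽

_*₄_ : 𝔽₄ → 𝔽₄ → 𝔽₄
0𝔽 *₄ y = 0𝔽
1𝔽 *₄ y = y
x *₄ 0𝔽 = 0𝔽
x *₄ 1𝔽 = x
ω *₄ ω = ω²
ω *₄ ω² = 1𝔽
ω² *₄ ω = 1𝔽
ω² *₄ ω² = ω

-- 𝔽₄ is finite, so its identities are decided by exhaustive evaluation.

+₄-assoc : ∀ x y z → x +₄ y +₄ z ≡ x +₄ (y +₄ z)
+₄-assoc = from-yes (all? λ x → all? λ y → all? λ z → x +₄ y +₄ z ≟ x +₄ (y +₄ z))

+₄-comm : ∀ x y → x +₄ y ≡ y +₄ x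
+₄-comm = from-yes (all? λ x → all? λ y → x +₄ y ≟ y +₄ x)

+₄-identityʳ : ∀ x → x +₄ 0𝔽 ≡ x
+₄-identityʳ = from-yes (all? λ x → x +₄ 0𝔽 ≟ x)

*₄-zeroʳ : ∀ x → x *₄ 0𝔽 ≡ 0𝔽
*₄-zeroʳ = from-yes (all? λ x → x *₄ 0𝔽 ≟ 0𝔽)

*₄-assoc : ∀ x y z → x *₄ y *₄ z ≡ x *₄ (y *₄ z)
*₄-assoc = from-yes (all? λ x → all? λ y → all? λ z → x *₄ y *₄ z ≟ x *₄ (y *₄ z))

*₄-distribʳ : ∀ x y z → (y +₄ z) *₄ x ≡ y *₄ x +₄ z *₄ x
*₄-distribʳ = from-yes (all? λ x → all? λ y → all? λ z → (y +₄ z) *₄ x ≟ y *₄ x +₄ z *₄ x)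

+₄-self-inverse : ∀ x y → x +₄ y ≡ 0𝔽 → x ≡ y
+₄-self-inverse = from-yes (all? λ x → all? λ y → (x +₄ y ≟ 0𝔽) →-dec (x ≟ y))

IsPrimitiveCubeRoot : 𝔽₄ → Set
IsPrimitiveCubeRoot c = c *₄ c +₄ c +₄ 1𝔽 ≡ 0𝔽

square-isPrimitiveCubeRoot : ∀ c → IsPrimitiveCubeRoot c → IsPrimitiveCubeRoot (c *₄ c)
square-isPrimitiveCubeRoot = from-yes (all? λ c →
  (c *₄ c +₄ c +₄ 1𝔽 ≟ 0𝔽) →-dec ((c *₄ c) *₄ (c *₄ c) +₄ c *₄ c +₄ 1𝔽 ≟ 0𝔽))

x+xc+xc²≡0 : ∀ c x → IsPrimitiveCubeRoot c → x *₄ 1𝔽 +₄ (x *₄ c +₄ (x *₄ (c *₄ c) +₄ 0𝔽)) ≡ 0𝔽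
x+xc+xc²≡0 = from-yes (all? λ c → all? λ x →
  (c *₄ c +₄ c +₄ 1𝔽 ≟ 0𝔽) →-dec (x *₄ 1𝔽 +₄ (x *₄ c +₄ (x *₄ (c *₄ c) +₄ 0𝔽)) ≟ 0𝔽))

ℕ→𝔽₄ : ℕ → 𝔽₄
ℕ→𝔽₄ zero = 0𝔽
ℕ→𝔽₄ (suc n) = 1𝔽 +₄ ℕ→𝔽₄ n

ℕ→𝔽₄-+ : ∀ m n → ℕ→𝔽₄ (m + n) ≡ ℕ→𝔽₄ m +₄ ℕ→𝔽₄ n
ℕ→𝔽₄-+ zero n = refl
ℕ→𝔽₄-+ (suc m) n = trans (cong (1𝔽 +₄_) (ℕ→𝔽₄-+ m n)) (sym (+₄-assoc 1𝔽 (ℕ→𝔽₄ m) (ℕ→𝔽₄ n)))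

ℕ→𝔽₄-* : ∀ m n → ℕ→𝔽₄ (m * n) ≡ ℕ→𝔽₄ m *₄ ℕ→𝔽₄ n
ℕ→𝔽₄-* zero n = refl
ℕ→𝔽₄-* (suc m) n = trans (ℕ→𝔽₄-+ n (m * n))
  (trans (cong (ℕ→𝔽₄ n +₄_) (ℕ→𝔽₄-* m n)) (sym (*₄-distribʳ (ℕ→𝔽₄ n) 1𝔽 (ℕ→𝔽₄ m))))

ℕ→𝔽₄-3^ : ∀ n → ℕ→𝔽₄ (3 ^ n) ≡ 1𝔽
ℕ→𝔽₄-3^ zero = refl
ℕ→𝔽₄-3^ (suc n) = trans (ℕ→𝔽₄-* 3 (3 ^ n)) (ℕ→𝔽₄-3^ n)

ℤ→𝔽₄ : ℤ → 𝔽₄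
ℤ→𝔽₄ a = ℕ→𝔽₄ ℤ.∣ a ∣

ℤ→𝔽₄-⊖ : ∀ m n → ℤ→𝔽₄ (m ℤ.⊖ n) ≡ ℕ→𝔽₄ m +₄ ℕ→𝔽₄ n
ℤ→𝔽₄-⊖ zero zero = refl
ℤ→𝔽₄-⊖ zero (suc n) = refl
ℤ→𝔽₄-⊖ (suc m) zero = sym (+₄-identityʳ _)
ℤ→𝔽₄-⊖ (suc m) (suc n) = trans (cong ℤ→𝔽₄ (ℤ.[1+m]⊖[1+n]≡m⊖n m n)) (trans (ℤ→𝔽₄-⊖ m n) (cancel-1 (ℕ→𝔽₄ m) (ℕ→𝔽₄ n)))
  where
  cancel-1 : ∀ x y → x +₄ y ≡ (1𝔽 +₄ x) +₄ (1𝔽 +₄ y)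
  cancel-1 = from-yes (all? λ x → all? λ y → x +₄ y ≟ (1𝔽 +₄ x) +₄ (1𝔽 +₄ y))

ℤ→𝔽₄-+ : ∀ a b → ℤ→𝔽₄ (a ℤ.+ b) ≡ ℤ→𝔽₄ a +₄ ℤ→𝔽₄ b
ℤ→𝔽₄-+ (+ m) (+ n) = ℕ→𝔽₄-+ m n
ℤ→𝔽₄-+ (+ m) ℤ.-[1+ n ] = ℤ→𝔽₄-⊖ m (suc n)
ℤ→𝔽₄-+ ℤ.-[1+ m ] (+ n) = trans (ℤ→𝔽₄-⊖ n (suc m)) (+₄-comm (ℕ→𝔽₄ n) _)
ℤ→𝔽₄-+ ℤ.-[1+ m ] ℤ.-[1+ n ] = trans (cong (λ k → ℕ→𝔽₄ (suc k)) (sym (ℕ.+-suc m n))) (ℕ→𝔽₄-+ (suc m) (suc n))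

ℤ→𝔽₄-* : ∀ a b → ℤ→𝔽₄ (a ℤ.* b) ≡ ℤ→𝔽₄ a *₄ ℤ→𝔽₄ b
ℤ→𝔽₄-* a b = trans (cong ℕ→𝔽₄ (ℤ.abs-* a b)) (ℕ→𝔽₄-* ℤ.∣ a ∣ ℤ.∣ b ∣)

ℤ→𝔽₄-neg : ∀ a → ℤ→𝔽₄ (ℤ.- a) ≡ ℤ→𝔽₄ a
ℤ→𝔽₄-neg a = cong ℕ→𝔽₄ (ℤ.∣-i∣≡∣i∣ a)

eval : Poly → 𝔽₄
eval [] = 0𝔽
eval (a ∷ p) = ℤ→𝔽₄ a +₄ ω *₄ eval p

eval-+ₚ : ∀ p q → eval (p +ₚ q) ≡ eval p +₄ eval q
eval-+ₚ [] q = refl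
eval-+ₚ (a ∷ p) [] = sym (+₄-identityʳ _)
eval-+ₚ (a ∷ p) (b ∷ q) = trans (cong₂ (λ c r → c +₄ ω *₄ r) (ℤ→𝔽₄-+ a b) (eval-+ₚ p q))
  (regroup (ℤ→𝔽₄ a) (ℤ→𝔽₄ b) (eval p) (eval q))
  where
  regroup : ∀ a b x y → (a +₄ b) +₄ ω *₄ (x +₄ y) ≡ (a +₄ ω *₄ x) +₄ (b +₄ ω *₄ y)
  regroup = from-yes (all? λ a → all? λ b → all? λ x → all? λ y →
    (a +₄ b) +₄ ω *₄ (x +₄ y) ≟ (a +₄ ω *₄ x) +₄ (b +₄ ω *₄ y))

eval-negₚ : ∀ p → eval (negₚ p) ≡ eval p
eval-negₚ [] = refl
eval-negₚ (a ∷ p) = cong₂ (λ c r → c +₄ ω *₄ r) (ℤ→𝔽₄-neg a) (eval-negₚ p)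

eval-scale : ∀ a q → eval (scale a q) ≡ ℤ→𝔽₄ a *₄ eval q
eval-scale a [] = sym (*₄-zeroʳ (ℤ→𝔽₄ a))
eval-scale a (b ∷ q) = trans (cong₂ (λ c r → c +₄ ω *₄ r) (ℤ→𝔽₄-* a b) (eval-scale a q))
  (regroup (ℤ→𝔽₄ a) (ℤ→𝔽₄ b) (eval q))
  where
  regroup : ∀ a b x → a *₄ b +₄ ω *₄ (a *₄ x) ≡ a *₄ (b +₄ ω *₄ x)
  regroup = from-yes (all? λ a → all? λ b → all? λ x → a *₄ b +₄ ω *₄ (a *₄ x) ≟ a *₄ (b +₄ ω *₄ x))

eval-*ₚ : ∀ p q → eval (p *ₚ q) ≡ eval p *₄ eval q
eval-*ₚ [] q = refl
eval-*ₚ (a ∷ p) q = trans (eval-+ₚ (scale a q) (0ℤ ∷ p *ₚ q))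
  (trans (cong₂ (λ s r → s +₄ ω *₄ r) (eval-scale a q) (eval-*ₚ p q))
  (regroup (ℤ→𝔽₄ a) (eval p) (eval q)))
  where
  regroup : ∀ a x y → a *₄ y +₄ ω *₄ (x *₄ y) ≡ (a +₄ ω *₄ x) *₄ y
  regroup = from-yes (all? λ a → all? λ x → all? λ y → a *₄ y +₄ ω *₄ (x *₄ y) ≟ (a +₄ ω *₄ x) *₄ y)

eval-vanishes : ∀ {p} → p ≈ₚ [] → eval p ≡ 0𝔽
eval-vanishes {[]} _ = refl
eval-vanishes {a ∷ p} p≈[] rewrite coeff-≡ p≈[] 0 | eval-vanishes {p} (coeffwise λ i → coeff-≡ p≈[] (suc i)) = refl

eval-−ₚ : ∀ p q → eval (p -ₚ q) ≡ eval p +₄ eval q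
eval-−ₚ p q = trans (eval-+ₚ p (negₚ q)) (cong (eval p +₄_) (eval-negₚ q))

eval-cong : ∀ {p q} → p ≈ₚ q → eval p ≡ eval q
eval-cong {p} {q} p≈q = +₄-self-inverse (eval p) (eval q)
  (trans (sym (eval-−ₚ p q)) (eval-vanishes (≈ₚ-trans (+ₚ-cong p≈q ≈ₚ-refl) (+ₚ-inverseʳ q))))

ω^ : ℕ → 𝔽₄
ω^ zero = 1𝔽
ω^ (suc e) = ω *₄ ω^ e

ω^-+ : ∀ a b → ω^ (a + b) ≡ ω^ a *₄ ω^ b
ω^-+ zero b = refl
ω^-+ (suc a) b = trans (cong (ω *₄_) (ω^-+ a b)) (sym (*₄-assoc ω (ω^ a) (ω^ b)))

ω^-3* : ∀ t → ω^ (3 * t) ≡ 1𝔽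
ω^-3* zero = refl
ω^-3* (suc t) = trans (cong ω^ (ℕ.*-suc 3 t)) (trans (ω^-+ 3 (3 * t)) (cong (1𝔽 *₄_) (ω^-3* t)))

ω^-2* : ∀ a → ω^ (2 * a) ≡ ω^ a *₄ ω^ a
ω^-2* a = trans (cong (λ b → ω^ (a + b)) (ℕ.+-identityʳ a)) (ω^-+ a a)

ω^2^-isPrimitiveCubeRoot : ∀ j → IsPrimitiveCubeRoot (ω^ (2 ^ j))
ω^2^-isPrimitiveCubeRoot zero = refl
ω^2^-isPrimitiveCubeRoot (suc j) =
  subst IsPrimitiveCubeRoot (sym (ω^-2* (2 ^ j))) (square-isPrimitiveCubeRoot (ω^ (2 ^ j)) (ω^2^-isPrimitiveCubeRoot j))

eval-X^ : ∀ e → eval (X^ e) ≡ ω^ e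
eval-X^ zero = refl
eval-X^ (suc e) = cong (ω *₄_) (eval-X^ e)

eval-cyclotomic-3*2^ : ∀ j → eval (cyclotomic-3*2^ j) ≡ 0𝔽
eval-cyclotomic-3*2^ zero = refl
eval-cyclotomic-3*2^ (suc j) = begin
  eval (X^ (2 ^ suc j) -ₚ X^ (2 ^ j) +ₚ const 1ℤ)          ≡⟨ eval-+ₚ (X^ (2 ^ suc j) -ₚ X^ (2 ^ j)) (const 1ℤ) ⟩
  eval (X^ (2 ^ suc j) -ₚ X^ (2 ^ j)) +₄ 1𝔽                ≡⟨ cong (_+₄ 1𝔽) (eval-+ₚ (X^ (2 ^ suc j)) (negₚ (X^ (2 ^ j)))) ⟩
  eval (X^ (2 ^ suc j)) +₄ eval (negₚ (X^ (2 ^ j))) +₄ 1𝔽  ≡⟨ cong₂ (λ a b → a +₄ b +₄ 1𝔽) (eval-X^ (2 ^ suc j)) (trans (eval-negₚ (X^ (2 ^ j))) (eval-X^ (2 ^ j))) ⟩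
  ω^ (2 * 2 ^ j) +₄ ω^ (2 ^ j) +₄ 1𝔽                       ≡⟨ cong (λ a → a +₄ ω^ (2 ^ j) +₄ 1𝔽) (ω^-2* (2 ^ j)) ⟩
  ω^ (2 ^ j) *₄ ω^ (2 ^ j) +₄ ω^ (2 ^ j) +₄ 1𝔽             ≡⟨ ω^2^-isPrimitiveCubeRoot j ⟩
  0𝔽                                                       ∎
  where open ≡-Reasoning

Φ-3*2^ : ∀ k → Φ (Nk k) ≈ₚ cyclotomic-3*2^ k
Φ-3*2^ k = cycloF-3*2^ (Nk k) k ℕ.≤-refl

eval-Φ-3*2^ : ∀ k → eval (Φ (Nk k)) ≡ 0𝔽
eval-Φ-3*2^ k = trans (eval-cong (Φ-3*2^ k)) (eval-cyclotomic-3*2^ k)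

eval-cong-mod-Φ : ∀ k p q → p ≈[ Nk k ] q → eval p ≡ eval q
eval-cong-mod-Φ k p q (Q , p-q≡QΦ) = +₄-self-inverse (eval p) (eval q) (begin
  eval p +₄ eval q          ≡⟨ eval-−ₚ p q ⟨
  eval (p -ₚ q)             ≡⟨ eval-cong {p -ₚ q} {Q *ₚ Φ (Nk k)} (coeffwise p-q≡QΦ) ⟩
  eval (Q *ₚ Φ (Nk k))      ≡⟨ eval-*ₚ Q (Φ (Nk k)) ⟩
  eval Q *₄ eval (Φ (Nk k)) ≡⟨ cong (eval Q *₄_) (eval-Φ-3*2^ k) ⟩
  eval Q *₄ 0𝔽              ≡⟨ *₄-zeroʳ (eval Q) ⟩
  0𝔽                        ∎)
  where open ≡-Reasoning

≡⇒≈[] : ∀ {N p q} → p ≡ q → p ≈[ N ] q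
≡⇒≈[] {p = p} refl = [] , coeff-≡ (+ₚ-inverseʳ p)

X^-periodic : ∀ k e → X^ e ≈[ Nk k ] X^ (e + Nk k)
X^-periodic k e = Q , coeff-≡ (begin
  X^ e -ₚ X^ (e + Nk k)           ≈⟨ +ₚ-cong ≈ₚ-refl (negₚ-cong (X^-+ e (Nk k))) ⟩
  y -ₚ y *ₚ X^ (Nk k)             ≈⟨ solve 2 (λ y z → y :- y :* z :≈ :- (y :* (z :- con 1ℤ))) ≈ₚ-refl y (X^ (Nk k)) ⟩
  negₚ (y *ₚ (X^ (Nk k) -ₚ const 1ℤ))  ≈⟨ negₚ-cong (*ₚ-congʳ y (X^3*2^-1-factorisation k)) ⟩
  negₚ (y *ₚ (Φ₃ *ₚ D))            ≈⟨ solve 3 (λ y Φ₃ D → :- (y :* (Φ₃ :* D)) :≈ :- (y :* D) :* Φ₃) ≈ₚ-refl y Φ₃ D ⟩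
  Q *ₚ Φ₃                          ≈⟨ *ₚ-congʳ Q (Φ-3*2^ k) ⟨
  Q *ₚ Φ (Nk k)                    ∎)
  where
  open ≈ₚ-Reasoning
  y Φ₃ D Q : Poly
  y = X^ e
  Φ₃ = cyclotomic-3*2^ k
  D = ∏< cyclotomic-2^ (suc k) *ₚ ∏< cyclotomic-3*2^ k
  Q = negₚ (y *ₚ D)

-- A character whose Walsh sum vanishes in 𝔽₄

pattern 1F = sucF 0F
pattern 2F = sucF 1F

toℕ-+₃ : ∀ a b → toℕ a + toℕ b ≡ toℕ (a +₃ b) ⊎ toℕ a + toℕ b ≡ toℕ (a +₃ b) + 3
toℕ-+₃ 0F 0F = inj₁ refl
toℕ-+₃ 0F 1F = inj₁ refl
toℕ-+₃ 0F 2F = inj₁ refl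
toℕ-+₃ 1F 0F = inj₁ refl
toℕ-+₃ 1F 1F = inj₁ refl
toℕ-+₃ 1F 2F = inj₂ refl
toℕ-+₃ 2F 0F = inj₁ refl
toℕ-+₃ 2F 1F = inj₂ refl
toℕ-+₃ 2F 2F = inj₂ refl

-- The character x ↦ ζ₃^{x₀} = ζ_N^{2^k x₀} of ℤ₃^{n+1}.
firstCharacter : ∀ n k → Vec (Fin 3) (suc n) → ℕ
firstCharacter n k (a ∷ _) = 2 ^ k * toℕ a

firstCharacter-isCharacter : ∀ n k → IsCharacter (suc n) k (firstCharacter n k)
firstCharacter-isCharacter n k (a ∷ _) (b ∷ _) with toℕ-+₃ a b
... | inj₁ eq = ≡⇒≈[] {Nk k} (cong X^ (trans (cong (2 ^ k *_) (sym eq)) (ℕ.*-distribˡ-+ (2 ^ k) (toℕ a) (toℕ b))))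
... | inj₂ eq = subst (λ e → X^ (2 ^ k * toℕ (a +₃ b)) ≈[ Nk k ] X^ e) shift (X^-periodic k (2 ^ k * toℕ (a +₃ b)))
  where
  shift : 2 ^ k * toℕ (a +₃ b) + 3 * 2 ^ k ≡ 2 ^ k * toℕ a + 2 ^ k * toℕ b
  shift = begin
    2 ^ k * toℕ (a +₃ b) + 3 * 2 ^ k    ≡⟨ cong (λ x → 2 ^ k * toℕ (a +₃ b) + x) (ℕ.*-comm 3 (2 ^ k)) ⟩
    2 ^ k * toℕ (a +₃ b) + 2 ^ k * 3    ≡⟨ ℕ.*-distribˡ-+ (2 ^ k) (toℕ (a +₃ b)) 3 ⟨
    2 ^ k * (toℕ (a +₃ b) + 3)          ≡⟨ cong (2 ^ k *_) eq ⟨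
    2 ^ k * (toℕ a + toℕ b)             ≡⟨ ℕ.*-distribˡ-+ (2 ^ k) (toℕ a) (toℕ b) ⟩
    2 ^ k * toℕ a + 2 ^ k * toℕ b       ∎
    where open ≡-Reasoning

Σ₄ : {A : Set} → (A → 𝔽₄) → List A → 𝔽₄
Σ₄ h = L.foldr (λ x s → h x +₄ s) 0𝔽

eval-sumₚ : ∀ {A : Set} (g : A → Poly) xs → eval (sumₚ (L.map g xs)) ≡ Σ₄ (λ x → eval (g x)) xs
eval-sumₚ g [] = refl
eval-sumₚ g (x ∷ xs) = trans (eval-+ₚ (g x) (sumₚ (L.map g xs))) (cong (eval (g x) +₄_) (eval-sumₚ g xs))

Σ₄-cong : ∀ {A : Set} {h h′ : A → 𝔽₄} xs → (∀ x → h x ≡ h′ x) → Σ₄ h xs ≡ Σ₄ h′ xs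
Σ₄-cong [] _ = refl
Σ₄-cong (x ∷ xs) h≗h′ = cong₂ _+₄_ (h≗h′ x) (Σ₄-cong xs h≗h′)

Σ₄-++ : ∀ {A : Set} (h : A → 𝔽₄) xs ys → Σ₄ h (xs ++ ys) ≡ Σ₄ h xs +₄ Σ₄ h ys
Σ₄-++ h [] ys = refl
Σ₄-++ h (x ∷ xs) ys = trans (cong (h x +₄_) (Σ₄-++ h xs ys)) (sym (+₄-assoc (h x) (Σ₄ h xs) (Σ₄ h ys)))

Σ₄-map : ∀ {A B : Set} (h : B → 𝔽₄) (g : A → B) xs → Σ₄ h (L.map g xs) ≡ Σ₄ (λ x → h (g x)) xs
Σ₄-map h g [] = refl
Σ₄-map h g (x ∷ xs) = cong (h (g x) +₄_) (Σ₄-map h g xs)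

Σ₄-const : ∀ {A : Set} (c : 𝔽₄) (xs : List A) → Σ₄ (λ _ → c) xs ≡ ℕ→𝔽₄ (L.length xs) *₄ c
Σ₄-const c [] = refl
Σ₄-const c (x ∷ xs) = trans (cong (c +₄_) (Σ₄-const c xs)) (sym (*₄-distribʳ c 1𝔽 (ℕ→𝔽₄ (L.length xs))))

Σ₄-allZ3-suc : ∀ n (h : Vec (Fin 3) (suc n) → 𝔽₄) → Σ₄ h (allZ3 (suc n)) ≡
  Σ₄ (λ v → h (0F ∷ v)) (allZ3 n) +₄ (Σ₄ (λ v → h (1F ∷ v)) (allZ3 n) +₄ (Σ₄ (λ v → h (2F ∷ v)) (allZ3 n) +₄ 0𝔽))
Σ₄-allZ3-suc n h = begin
  Σ₄ h (slice 0F ++ (slice 1F ++ (slice 2F ++ [])))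
    ≡⟨ Σ₄-++ h (slice 0F) _ ⟩
  Σ₄ h (slice 0F) +₄ Σ₄ h (slice 1F ++ (slice 2F ++ []))
    ≡⟨ cong (Σ₄ h (slice 0F) +₄_) (Σ₄-++ h (slice 1F) _) ⟩
  Σ₄ h (slice 0F) +₄ (Σ₄ h (slice 1F) +₄ Σ₄ h (slice 2F ++ []))
    ≡⟨ cong (λ s → Σ₄ h (slice 0F) +₄ (Σ₄ h (slice 1F) +₄ s)) (Σ₄-++ h (slice 2F) []) ⟩
  Σ₄ h (slice 0F) +₄ (Σ₄ h (slice 1F) +₄ (Σ₄ h (slice 2F) +₄ 0𝔽))
    ≡⟨ cong₂ _+₄_ (Σ₄-map h (0F ∷_) (allZ3 n))
                  (cong₂ (λ s t → s +₄ (t +₄ 0𝔽)) (Σ₄-map h (1F ∷_) (allZ3 n)) (Σ₄-map h (2F ∷_) (allZ3 n))) ⟩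
  Σ₄ (λ v → h (0F ∷ v)) (allZ3 n) +₄ (Σ₄ (λ v → h (1F ∷ v)) (allZ3 n) +₄ (Σ₄ (λ v → h (2F ∷ v)) (allZ3 n) +₄ 0𝔽)) ∎
  where
  open ≡-Reasoning
  slice : Fin 3 → List (Vec (Fin 3) (suc n))
  slice a = L.map (a ∷_) (allZ3 n)

eval-walsh-firstCharacter : ∀ n k f → eval (walsh (suc n) k f (firstCharacter n k)) ≡ 0𝔽
eval-walsh-firstCharacter n k f = begin
  eval (walsh (suc n) k f χ)                                    ≡⟨ eval-sumₚ term (allZ3 (suc n)) ⟩
  Σ₄ (λ x → eval (term x)) (allZ3 (suc n))                      ≡⟨ Σ₄-cong (allZ3 (suc n)) eval-term ⟩
  Σ₄ (λ x → ω^ (χ x)) (allZ3 (suc n))                           ≡⟨ Σ₄-allZ3-suc n (λ x → ω^ (χ x)) ⟩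
  Σ₄ (λ _ → ω^ (2 ^ k * 0)) R +₄ (Σ₄ (λ _ → ω^ (2 ^ k * 1)) R +₄ (Σ₄ (λ _ → ω^ (2 ^ k * 2)) R +₄ 0𝔽))
    ≡⟨ cong₂ _+₄_ (Σ₄-const _ R) (cong₂ (λ s t → s +₄ (t +₄ 0𝔽)) (Σ₄-const _ R) (Σ₄-const _ R)) ⟩
  P *₄ ω^ (2 ^ k * 0) +₄ (P *₄ ω^ (2 ^ k * 1) +₄ (P *₄ ω^ (2 ^ k * 2) +₄ 0𝔽))
    ≡⟨ cong₂ _+₄_ (cong (λ e → P *₄ ω^ e) (ℕ.*-zeroʳ (2 ^ k)))
                  (cong₂ (λ s t → P *₄ s +₄ (P *₄ t +₄ 0𝔽)) (cong ω^ (ℕ.*-identityʳ (2 ^ k))) ω^2^k*2≡c*c) ⟩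
  P *₄ 1𝔽 +₄ (P *₄ c +₄ (P *₄ (c *₄ c) +₄ 0𝔽))                 ≡⟨ x+xc+xc²≡0 c P (ω^2^-isPrimitiveCubeRoot k) ⟩
  0𝔽                                                            ∎
  where
  open ≡-Reasoning
  χ : Vec (Fin 3) (suc n) → ℕ
  χ = firstCharacter n k
  term : Vec (Fin 3) (suc n) → Poly
  term x = X^ (3 * toℕ (f x) + χ x)
  eval-term : ∀ x → eval (term x) ≡ ω^ (χ x)
  eval-term x = trans (eval-X^ (3 * toℕ (f x) + χ x))
    (trans (ω^-+ (3 * toℕ (f x)) (χ x)) (cong (_*₄ ω^ (χ x)) (ω^-3* (toℕ (f x)))))
  R : List (Vec (Fin 3) n)
  R = allZ3 n
  P c : 𝔽₄
  P = ℕ→𝔽₄ (L.length R)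
  c = ω^ (2 ^ k)
  ω^2^k*2≡c*c : ω^ (2 ^ k * 2) ≡ c *₄ c
  ω^2^k*2≡c*c = trans (cong ω^ (ℕ.*-comm (2 ^ k) 2)) (ω^-2* (2 ^ k))

theorem4p1 : (n k : ℕ) → 1 ≤ n → 1 ≤ k →
    (f : Vec (Fin 3) n → Fin (2 ^ k)) → ¬ IsGBent n k f
theorem4p1 zero k () _ f
theorem4p1 (suc n) k _ _ f bent = 0𝔽≢1𝔽 (begin
  0𝔽                              ≡⟨ cong (_*₄ eval (conj (Nk k) W)) (eval-walsh-firstCharacter n k f) ⟨
  eval W *₄ eval (conj (Nk k) W)  ≡⟨ eval-*ₚ W (conj (Nk k) W) ⟨
  eval (normSq (Nk k) W)          ≡⟨ eval-cong-mod-Φ k (normSq (Nk k) W) (const (+ (3 ^ suc n))) (bent χ (firstCharacter-isCharacter n k)) ⟩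
  eval (const (+ (3 ^ suc n)))    ≡⟨ +₄-identityʳ _ ⟩
  ℕ→𝔽₄ (3 ^ suc n)                ≡⟨ ℕ→𝔽₄-3^ (suc n) ⟩
  1𝔽                              ∎)
  where
  open ≡-Reasoning
  χ : Vec (Fin 3) (suc n) → ℕ
  χ = firstCharacter n k
  W : Poly
  W = walsh (suc n) k f χ
  0𝔽≢1𝔽 : 0𝔽 ≢ 1𝔽
  0𝔽≢1𝔽 ()
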